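{- Let $V$ be a finite set of Boolean variables, $\Phi$ a propositional formula over $V$, $\psi$ a specification, and $\gamma$ a generalizer. Let $\mathsf{Sol}$ denote the set of assignments output by an execution of $\mathrm{GCG}(\Phi,\psi,\gamma)$. (1) (Soundness) In every execution, every $\sigma\in\mathsf{Sol}$ satisfies $\sigma\models\Phi$ and $M_\sigma\models\psi$. (2) (Completeness) If $\gamma$ is proper, then for every terminated execution and every assignment $\sigma$ with $\sigma\models\Phi$ and $M_\sigma\models\psi$, we have $\sigma\in\mathsf{Sol}$.
   Context: Setting. Each assignment $\sigma:V\to\{0,1\}$ determines a model $M_\sigma$ (e.g. a labeled transition system), and $\psi$ is a specification with a satisfaction relation, written $M\models\psi$ / $M\not\models\psi$. For an assignment $\sigma$ and a formula $\varphi$ over $V$, $\sigma\models\varphi$ means $\sigma$ satisfies $\varphi$. An assignment $\sigma$ is also identified with the formula satisfied by $\sigma$ and by no other assignment, so $\neg\sigma$ is satisfied by all assignments except $\sigma$. A generalizer is a function $\gamma$ mapping assignments to propositional formulas over $V$. It is proper (with respect to the input formula $\Phi$ and $\psi$) if for every $\sigma$ with $\sigma\models\Phi$ and $M_\sigma\not\models\psi$: (i) $\sigma\models\gamma(\sigma)$; and (ii) for every $\rho$ with $\rho\models\Phi$ and $M_\rho\models\psi$, we have $\rho\not\models\gamma(\sigma)$. Algorithm $\mathrm{GCG}(\Phi,\psi,\gamma)$ (enumeration mode). Keep a current formula $\Phi_{cur}$, initialized to $\Phi$. While $\Phi_{cur}$ is satisfiable: - pick an arbitrary assignment $\sigma$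 with $\sigma\models\Phi_{cur}$ (a "candidate"); - if $M_\sigma\models\psi$, output $\sigma$ (a "solution") and set $\Phi_{cur}:=\Phi_{cur}\wedge\neg\sigma$; - otherwise set $\Phi_{cur}:=\Phi_{cur}\wedge\neg\gamma(\sigma)$. -}

module Defs where

open import Data.Nat using (ℕ)
open import Data.Fin using (Fin)
open import Data.Bool using (Bool; true; false; T; not)
open import Data.Vec using (Vec; lookup)
open import Data.List using (List; []; _∷_; foldr; allFin)
open import Data.Product using (Σ; ∃; _×_)
open import Relation.Nullary using (¬_)

Assignment : ℕ → Set
Assignment n = Vec Bool n

data Formula (n : ℕ) : Set where
  var  : Fin n → Formula n
  tt   : Formula n
  ff   : Formula n
  neg  : Formula n → Formula n
  _∧ᶠ_ : Formula n → Formula n → Formula n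
  _∨ᶠ_ : Formula n → Formula n → Formula n

eval : ∀ {n} → Assignment n → Formula n → Bool
eval σ (var i)  = lookup σ i
eval σ tt       = true
eval σ ff       = false
eval σ (neg φ)  = not (eval σ φ)
eval σ (φ ∧ᶠ ψ) = eval σ φ Data.Bool.∧ eval σ ψ
eval σ (φ ∨ᶠ ψ) = eval σ φ Data.Bool.∨ eval σ ψ

_⊨_ : ∀ {n} → Assignment n → Formula n → Set
σ ⊨ φ = T (eval σ φ)

Satisfiable : ∀ {n} → Formula n → Set
Satisfiable {n} φ = Σ (Assignment n) λ σ → σ ⊨ φ

-- The formula identified with an assignment σ: the conjunction of the
-- literals x_i (if σ i = 1) or ¬x_i (if σ i = 0), satisfied by σ only.
literal : ∀ {n} → Fin n → Bool → Formula n
literal i true  = var i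
literal i false = neg (var i)

asFormula : ∀ {n} → Assignment n → Formula n
asFormula {n} σ = foldr (λ i acc → literal i (lookup σ i) ∧ᶠ acc) tt (allFin n)

Generalizer : ℕ → Set
Generalizer n = Assignment n → Formula n

Proper : ∀ {n} {Model Spec : Set} (M : Assignment n → Model)
         (_⊨ₘ_ : Model → Spec → Set) (Φ : Formula n) (ψ : Spec)
         (γ : Generalizer n) → Set
Proper M _⊨ₘ_ Φ ψ γ =
  ∀ σ → σ ⊨ Φ → ¬ (M σ ⊨ₘ ψ) →
    (σ ⊨ γ σ) × (∀ ρ → ρ ⊨ Φ → M ρ ⊨ₘ ψ → ¬ (ρ ⊨ γ σ))

-- Reachable states of an (arbitrary, nondeterministic) execution of
-- GCG(Φ, ψ, γ): a state is the current formula Φcur together with the list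
-- of solutions output so far.  Each loop iteration picks a candidate σ ⊨ Φcur
-- (so Φcur is satisfiable, i.e. the loop guard holds).
data Reach {n} {Model Spec : Set} (M : Assignment n → Model)
           (_⊨ₘ_ : Model → Spec → Set) (Φ : Formula n) (ψ : Spec)
           (γ : Generalizer n) : Formula n → List (Assignment n) → Set where
  start : Reach M _⊨ₘ_ Φ ψ γ Φ []
  solution : ∀ {Φcur Sol} σ → Reach M _⊨ₘ_ Φ ψ γ Φcur Sol →
             σ ⊨ Φcur → M σ ⊨ₘ ψ →
             Reach M _⊨ₘ_ Φ ψ γ (Φcur ∧ᶠ neg (asFormula σ)) (σ ∷ Sol)
  generalize : ∀ {Φcur Sol} σ → Reach M _⊨ₘ_ Φ ψ γ Φcur Sol →
             σ ⊨ Φcur → ¬ (M σ ⊨ₘ ψ) →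
             Reach M _⊨ₘ_ Φ ψ γ (Φcur ∧ᶠ neg (γ σ)) Sol

{-# OPTIONS --safe #-}
module Submission where

-- Both parts are invariants of the reachable states of GCG.  Soundness: every
-- solution is output while it satisfies the current formula, which only ever
-- strengthens Φ.  Completeness: every ρ with ρ ⊨ Φ and M_ρ ⊨ ψ is either
-- already output or still satisfies the current formula, because the clause
-- ¬ρ' added after a solution ρ' ≠ ρ only excludes ρ', and properness says the
-- clause ¬γ(σ) added after a counterexample σ never excludes ρ.  Once the
-- current formula is unsatisfiable, the second alternative is impossible.

open import Defs
open import Data.Nat using (ℕ)
open import Data.Fin using (Fin)
open import Data.Bool using (true; false)
open import Data.Bool.Properties using (T-≡; T-∧; T-not-≡) renaming (_≟_ to _≟ᵇ_)
open import Data.Vec using (lookup; tabulate)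
open import Data.Vec.Properties using (tabulate∘lookup; tabulate-cong; ≡-dec)
open import Data.List using (List; _∷_; foldr; allFin)
open import Data.List.Membership.Propositional using (_∈_)
open import Data.List.Membership.Propositional.Properties using (∈-allFin)
open import Data.List.Relation.Unary.Any using (here; there)
open import Data.Product using (_×_; _,_; proj₁; proj₂)
open import Data.Sum using (_⊎_; inj₁; inj₂)
open import Data.Empty using (⊥-elim)
open import Function using (Equivalence)
open import Relation.Nullary using (¬_; yes; no)
open import Relation.Binary.PropositionalEquality using (_≡_; refl; module ≡-Reasoning)

open Equivalence using (to; from)

module _ {n : ℕ} (σ : Assignment n) where

  ⊨-∧ᶠ : ∀ φ χ → σ ⊨ (φ ∧ᶠ χ) → σ ⊨ φ × σ ⊨ χ
  ⊨-∧ᶠ _ _ = to T-∧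

  neg-⊨ : ∀ φ → ¬ σ ⊨ φ → σ ⊨ neg φ
  neg-⊨ φ ¬p with eval σ φ
  ... | true  = ¬p _
  ... | false = _

  ∧ᶠ-neg-⊨ : ∀ φ χ → σ ⊨ φ → ¬ σ ⊨ χ → σ ⊨ (φ ∧ᶠ neg χ)
  ∧ᶠ-neg-⊨ φ χ p ¬q = from T-∧ (p , neg-⊨ χ ¬q)

  ⊨-literal : ∀ i b → σ ⊨ literal i b → lookup σ i ≡ b
  ⊨-literal _ true  = to T-≡
  ⊨-literal _ false = to T-not-≡

literals : ∀ {n} → Assignment n → List (Fin n) → Formula n
literals σ = foldr (λ i acc → literal i (lookup σ i) ∧ᶠ acc) tt

⊨-literals : ∀ {n} (ρ σ : Assignment n) (is : List (Fin n)) →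
             ρ ⊨ literals σ is → ∀ {i} → i ∈ is → lookup ρ i ≡ lookup σ i
⊨-literals ρ σ (j ∷ is) p (here refl) =
  ⊨-literal ρ j (lookup σ j) (proj₁ (⊨-∧ᶠ ρ (literal j (lookup σ j)) (literals σ is) p))
⊨-literals ρ σ (j ∷ is) p (there i∈is) =
  ⊨-literals ρ σ is (proj₂ (⊨-∧ᶠ ρ (literal j (lookup σ j)) (literals σ is) p)) i∈is

⊨-asFormula⇒≡ : ∀ {n} (ρ σ : Assignment n) → ρ ⊨ asFormula σ → ρ ≡ σ
⊨-asFormula⇒≡ {n} ρ σ p = begin
  ρ                    ≡⟨ tabulate∘lookup ρ ⟨
  tabulate (lookup ρ)  ≡⟨ tabulate-cong (λ i → ⊨-literals ρ σ (allFin n) p (∈-allFin i)) ⟩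
  tabulate (lookup σ)  ≡⟨ tabulate∘lookup σ ⟩
  σ                    ∎
  where open ≡-Reasoning

module _ {n : ℕ} {Model Spec : Set} {M : Assignment n → Model}
         {_⊨ₘ_ : Model → Spec → Set} {Φ : Formula n} {ψ : Spec}
         {γ : Generalizer n} where

  Reach-⊨Φ : ∀ {Φcur Sol} → Reach M _⊨ₘ_ Φ ψ γ Φcur Sol →
             ∀ σ → σ ⊨ Φcur → σ ⊨ Φ
  Reach-⊨Φ start                       σ p = p
  Reach-⊨Φ (solution {Φcur} τ r _ _)   σ p =
    Reach-⊨Φ r σ (proj₁ (⊨-∧ᶠ σ Φcur (neg (asFormula τ)) p))
  Reach-⊨Φ (generalize {Φcur} τ r _ _) σ p =
    Reach-⊨Φ r σ (proj₁ (⊨-∧ᶠ σ Φcur (neg (γ τ)) p))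

  Reach-sound : ∀ {Φcur Sol} → Reach M _⊨ₘ_ Φ ψ γ Φcur Sol →
                ∀ σ → σ ∈ Sol → (σ ⊨ Φ) × (M σ ⊨ₘ ψ)
  Reach-sound (solution _ r σ⊨ σ⊨ψ) _ (here refl)  = Reach-⊨Φ r _ σ⊨ , σ⊨ψ
  Reach-sound (solution _ r _ _)     σ (there σ∈) = Reach-sound r σ σ∈
  Reach-sound (generalize _ r _ _)   σ σ∈         = Reach-sound r σ σ∈

  Reach-covers : Proper M _⊨ₘ_ Φ ψ γ →
                 ∀ {Φcur Sol} → Reach M _⊨ₘ_ Φ ψ γ Φcur Sol →
                 ∀ {ρ} → ρ ⊨ Φ → M ρ ⊨ₘ ψ → ρ ∈ Sol ⊎ ρ ⊨ Φcur
  Reach-covers proper start ρ⊨Φ _ = inj₂ ρ⊨Φ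
  Reach-covers proper (solution {Φcur} σ r _ _) {ρ} ρ⊨Φ ρ⊨ψ
    with Reach-covers proper r ρ⊨Φ ρ⊨ψ | ≡-dec _≟ᵇ_ ρ σ
  ... | inj₁ ρ∈     | _        = inj₁ (there ρ∈)
  ... | inj₂ _      | yes refl = inj₁ (here refl)
  ... | inj₂ ρ⊨cur  | no ρ≢σ   =
    inj₂ (∧ᶠ-neg-⊨ ρ Φcur (asFormula σ) ρ⊨cur (λ p → ρ≢σ (⊨-asFormula⇒≡ ρ σ p)))
  Reach-covers proper (generalize {Φcur} σ r σ⊨cur σ⊭ψ) {ρ} ρ⊨Φ ρ⊨ψ
    with Reach-covers proper r ρ⊨Φ ρ⊨ψ
  ... | inj₁ ρ∈    = inj₁ ρ∈
  ... | inj₂ ρ⊨cur = inj₂ (∧ᶠ-neg-⊨ ρ Φcur (γ σ) ρ⊨cur (γσ-excludes-solutions ρ ρ⊨Φ ρ⊨ψ))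
    where
    γσ-excludes-solutions : ∀ ρ → ρ ⊨ Φ → M ρ ⊨ₘ ψ → ¬ ρ ⊨ γ σ
    γσ-excludes-solutions = proj₂ (proper σ (Reach-⊨Φ r σ σ⊨cur) σ⊭ψ)

theorem1 : ∀ {n : ℕ} {Model Spec : Set} (M : Assignment n → Model)
           (_⊨ₘ_ : Model → Spec → Set) (Φ : Formula n) (ψ : Spec)
           (γ : Generalizer n) →
           (∀ {Φcur : Formula n} {Sol : List (Assignment n)} →
              Reach M _⊨ₘ_ Φ ψ γ Φcur Sol →
              ∀ σ → σ ∈ Sol → (σ ⊨ Φ) × (M σ ⊨ₘ ψ))
           ×
           (Proper M _⊨ₘ_ Φ ψ γ →
              ∀ {Φcur : Formula n} {Sol : List (Assignment n)} →
              Reach M _⊨ₘ_ Φ ψ γ Φcur Sol → ¬ Satisfiable Φcur →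
              ∀ σ → σ ⊨ Φ → M σ ⊨ₘ ψ → σ ∈ Sol)
theorem1 M _⊨ₘ_ Φ ψ γ = Reach-sound , completeness
  where
  completeness : Proper M _⊨ₘ_ Φ ψ γ →
                 ∀ {Φcur Sol} → Reach M _⊨ₘ_ Φ ψ γ Φcur Sol → ¬ Satisfiable Φcur →
                 ∀ σ → σ ⊨ Φ → M σ ⊨ₘ ψ → σ ∈ Sol
  completeness proper r unsat σ σ⊨Φ σ⊨ψ with Reach-covers proper r σ⊨Φ σ⊨ψ
  ... | inj₁ σ∈    = σ∈
  ... | inj₂ σ⊨cur = ⊥-elim (unsat (σ , σ⊨cur))
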